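{- For every integer $n \geq 7$ and every edge $e$ of the complete graph $K_{n+1}$, the graph $K_{n+1}-e$ obtained by deleting $e$ satisfies $\mu_s(K_{n+1}-e)=+\infty$.
   Context: All graphs are finite and simple. For integers $a\le b$, $[a,b]$ denotes the set of integers $x$ with $a\le x\le b$. A graph $G$ is super edge-magic if there is a bijection $f:V(G)\cup E(G)\to[1,|V(G)|+|E(G)|]$ with $f(V(G))=[1,|V(G)|]$ such that $f(u)+f(v)+f(uv)$ is the same constant for every edge $uv\in E(G)$. The super edge-magic deficiency $\mu_s(G)$ of a graph $G$ is the smallest nonnegative integer $k$ such that the disjoint union $G\cup kK_1$ of $G$ with $k$ isolated vertices is super edge-magic, or $+\infty$ if no such $k$ exists. -}

module Defs where

open import Data.Nat using (ℕ; suc; _+_; _≤_)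
open import Data.Fin using (Fin; toℕ; splitAt; _≟_) renaming (_<_ to _<ᶠ_)
open import Data.Bool using (Bool; false; not; _∧_; _∨_; T)
open import Data.Sum using (_⊎_; inj₁; inj₂)
open import Data.Product using (Σ; ∃; _×_; _,_)
open import Function.Bundles using (_⤖_; Bijection)
open import Relation.Binary.PropositionalEquality using (_≡_)
open import Relation.Nullary.Decidable using (⌊_⌋)

-- Only the values on pairs i < j are used, so the
-- edge set is the set of unordered pairs {i,j} (i < j) with adj i j = true.
-- (Simplicity is automatic: no loops, no multiple edges.)
Adjacency : ℕ → Set
Adjacency p = Fin p → Fin p → Bool

Edge : (p : ℕ) → Adjacency p → Set
Edge p adj = Σ (Fin p × Fin p) λ { (i , j) → (i <ᶠ j) × T (adj i j) }

src tgt : {p : ℕ} {adj : Adjacency p} → Edge p adj → Fin p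
src ((i , j) , _) = i
tgt ((i , j) , _) = j

-- The bijection is given onto Fin N with label  suc (toℕ _) ∈ [1,N];
-- a bijection V ⊎ E ⤖ Fin N forces N = |V| + |E|.
SuperEdgeMagic : (p : ℕ) → Adjacency p → Set
SuperEdgeMagic p adj =
  Σ ℕ λ N → Σ ((Fin p ⊎ Edge p adj) ⤖ Fin N) λ f →
    let lab : Fin p ⊎ Edge p adj → ℕ
        lab x = suc (toℕ (Bijection.to f x))
    in ((v : Fin p) → lab (inj₁ v) ≤ p)
     × ((m : ℕ) → 1 ≤ m → m ≤ p → ∃ λ v → lab (inj₁ v) ≡ m)
     × ∃ λ c → (e : Edge p adj) →
         lab (inj₁ (src e)) + lab (inj₁ (tgt e)) + lab (inj₂ e) ≡ c

-- (K_{n+1} - ab) ∪ k K_1 on the vertex set Fin (n + 1 + k):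
-- the first n+1 vertices form K_{n+1} with the edge {a,b} removed,
-- the remaining k vertices are isolated.
adjKminusEplusIso : (n k : ℕ) (a b : Fin (n + 1)) → Adjacency (n + 1 + k)
adjKminusEplusIso n k a b i j with splitAt (n + 1) i | splitAt (n + 1) j
... | inj₁ i′ | inj₁ j′ =
  not ⌊ i′ ≟ j′ ⌋ ∧
  not ((⌊ i′ ≟ a ⌋ ∧ ⌊ j′ ≟ b ⌋) ∨ (⌊ i′ ≟ b ⌋ ∧ ⌊ j′ ≟ a ⌋))
... | _ | _ = false

-- μ_s(G) = +∞  ⇔  G ∪ kK_1 is super edge-magic for no k.

module Submission where

-- In a super edge-magic labelling of (K_{n+1} − ab) ∪ kK₁ the labels f of the vertices of
-- K_{n+1} − ab are distinct, and the edge sums f u + f v are distinct and fill an interval.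
-- At the four lowest vertices s₁, …, s₄ the sums just above f s₁ + f s₂ and f s₁ + f s₃ must
-- be realised, which forces consecutive labels: f s₃ = f s₂ + 1 unless ab = s₁s₂, and
-- f s₄ = f s₃ + 1 or f s₂ = f s₁ + 1. Replacing f by C − f gives the same at the four highest
-- vertices t₁, …, t₄, disjoint from the lowest ones since there are at least eight vertices.
-- A low pair of labels x, x + 1 and a high pair y, y + 1 give the pairs {x, y + 1} and
-- {x + 1, y} of equal sum, so one of them is the missing edge ab; wherever a and b lie,
-- some choice of the two pairs contradicts this.

open import Defs
open import Data.Bool using (T; not; _∧_; _∨_)
open import Data.Empty using (⊥; ⊥-elim)
open import Data.Fin using (Fin; toℕ; fromℕ<; splitAt; _↑ˡ_; _≟_)
open import Data.Fin.Properties
  using (any?; pigeonhole; toℕ-injective; toℕ<n; toℕ-fromℕ<; toℕ-↑ˡ; ↑ˡ-injective; splitAt-↑ˡ; splitAt⁻¹-↑ˡ)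
  renaming (<⇒≢ to <ᶠ⇒≢)
open import Data.List using (List; []; _∷_; _++_; length; map; filter; allFin)
open import Data.List.Extrema.Nat using (argmin; argmin-sel; f[argmin]≤f[xs]; max; xs≤max)
open import Data.List.Membership.Propositional using (_∈_; _∉_)
open import Data.List.Membership.Propositional.Properties
  using (∈-allFin; ∈-filter⁺; ∈-filter⁻; ∈-map⁺; ∈-++⁺ˡ; ∈-++⁺ʳ)
open import Data.List.Membership.Setoid.Properties using (index-injective)
import Data.List.Relation.Unary.All as All
open import Data.List.Relation.Unary.Any as Any using (here; there; index)
open import Data.Nat using (ℕ; suc; _+_; _∸_; _≤_; _<_; _<?_; z≤n; s≤s; z<s; s<s)
open import Data.Nat.Properties hiding (_≟_)
open import Algebra.Properties.CommutativeSemigroup +-commutativeSemigroup using (interchange)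
open import Data.Product using (Σ; ∃; ∃₂; _×_; _,_; proj₁; proj₂; swap)
open import Data.Sum as Sum using (_⊎_; inj₁; inj₂; [_,_]′)
open import Data.Sum.Properties using (inj₁-injective)
open import Function using (_∘_; flip; case_of_)
open import Function.Bundles using (_⤖_; Bijection)
open import Relation.Binary using (tri<; tri≈; tri>)
open import Relation.Binary.PropositionalEquality
open import Relation.Nullary using (¬_; Dec; yes; no; contradiction)
open import Relation.Nullary.Decidable
  using (⌊_⌋; isYes≗does; ¬?; _×-dec_; _⊎-dec_; toWitness; fromWitness; decidable-stable)

module _ {x x′ y y′ : ℕ} (eq : x + x′ ≡ y + y′) where

  balanced-≡ : x ≡ y → x′ ≡ y′
  balanced-≡ refl = +-cancelˡ-≡ x _ _ eq

  balanced-≡ʳ : x′ ≡ y′ → x ≡ y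
  balanced-≡ʳ refl = +-cancelʳ-≡ x′ _ _ eq

  balanced-≤ : x ≤ y → y′ ≤ x′
  balanced-≤ x≤y = ≮⇒≥ λ x′<y′ → <-irrefl eq (+-mono-≤-< x≤y x′<y′)

  balanced-< : x < y → y′ < x′
  balanced-< x<y = ≰⇒> λ x′≤y′ → <-irrefl eq (+-mono-<-≤ x<y x′≤y′)

  balanced-suc : y ≡ suc x → x′ ≡ suc y′
  balanced-suc refl = +-cancelˡ-≡ x _ _ (trans eq (sym (+-suc x y′)))

+-cancelˡ-≤-suc : ∀ x {y z} → x + z ≤ suc (x + y) → z ≤ suc y
+-cancelˡ-≤-suc x {y} {z} h = +-cancelˡ-≤ x z (suc y) (subst (x + z ≤_) (sym (+-suc x y)) h)

+-cancelʳ-≤-suc : ∀ x {y z} → z + x ≤ suc (y + x) → z ≤ suc y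
+-cancelʳ-≤-suc x {y} {z} h =
  +-cancelˡ-≤-suc x (subst₂ (λ l r → l ≤ suc r) (+-comm z x) (+-comm y x) h)

_∈?_ : ∀ {m} (v : Fin m) (xs : List (Fin m)) → Dec (v ∈ xs)
v ∈? xs = Any.any? (v ≟_) xs

SamePair : {A : Set} → A → A → A → A → Set
SamePair x y z w = (x ≡ z × y ≡ w) ⊎ (x ≡ w × y ≡ z)

samePair? : ∀ {m} (x y z w : Fin m) → Dec (SamePair x y z w)
samePair? x y z w = (x ≟ z ×-dec y ≟ w) ⊎-dec (x ≟ w ×-dec y ≟ z)

private
  variable
    A : Set
    x y z w u v : A

SamePair-sym : SamePair x y z w → SamePair z w x y
SamePair-sym (inj₁ (refl , refl)) = inj₁ (refl , refl)
SamePair-sym (inj₂ (refl , refl)) = inj₂ (refl , refl)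

SamePair-swap : SamePair x y z w → SamePair y x z w
SamePair-swap (inj₁ p) = inj₂ (swap p)
SamePair-swap (inj₂ p) = inj₁ (swap p)

SamePair-trans : SamePair x y z w → SamePair z w u v → SamePair x y u v
SamePair-trans (inj₁ (refl , refl)) q = q
SamePair-trans (inj₂ (refl , refl)) q = SamePair-swap q

SamePair-sum : (g : A → ℕ) → SamePair x y z w → g x + g y ≡ g z + g w
SamePair-sum g (inj₁ (refl , refl)) = refl
SamePair-sum {x = x} {y = y} g (inj₂ (refl , refl)) = +-comm (g x) (g y)

SamePair-ordered : (g : A → ℕ) → SamePair x y z w → g x < g y → g z < g w → x ≡ z × y ≡ w
SamePair-ordered g (inj₁ p) _ _ = p
SamePair-ordered g (inj₂ (refl , refl)) x<y z<w = contradiction x<y (<-asym z<w)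

SamePair-injective : ∀ {B : Set} {g : A → B} → (∀ {x y} → g x ≡ g y → x ≡ y) →
                     SamePair (g x) (g y) (g z) (g w) → SamePair x y z w
SamePair-injective g-inj (inj₁ (p , q)) = inj₁ (g-inj p , g-inj q)
SamePair-injective g-inj (inj₂ (p , q)) = inj₂ (g-inj p , g-inj q)

Adjacent : ∀ {m} (a b u v : Fin m) → Set
Adjacent a b u v = u ≢ v × ¬ SamePair u v a b

Adjacent-sym : ∀ {m} {a b u v : Fin m} → Adjacent a b u v → Adjacent a b v u
Adjacent-sym (u≢v , ¬missing) = u≢v ∘ sym , ¬missing ∘ SamePair-swap

adjacent? : ∀ {m} (a b u v : Fin m) → Dec (Adjacent a b u v)
adjacent? a b u v = ¬? (u ≟ v) ×-dec ¬? (samePair? u v a b)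

∃-∉ : ∀ {m} (xs : List (Fin m)) → length xs < m → ∃ (_∉ xs)
∃-∉ {m} xs lt with any? (λ v → ¬? (v ∈? xs))
... | yes fresh = fresh
... | no ¬fresh =
  let i , j , i<j , same-index = pigeonhole lt (index ∘ ∈xs)
  in contradiction (index-injective (setoid (Fin m)) (∈xs i) (∈xs j) same-index) (<ᶠ⇒≢ i<j)
  where
  ∈xs : ∀ v → v ∈ xs
  ∈xs v = decidable-stable (v ∈? xs) (λ v∉xs → ¬fresh (v , v∉xs))

LeastOutside : ∀ {m} → (Fin m → ℕ) → List (Fin m) → Fin m → Set
LeastOutside g xs v = v ∉ xs × (∀ u → u ∉ xs → g v ≤ g u)

-- Opaque so that the vertices chosen below stay neutral: unfolding the search is costly.
opaque
  leastOutside : ∀ {m} (g : Fin m → ℕ) (xs : List (Fin m)) → length xs < m → ∃ (LeastOutside g xs)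
  leastOutside {m} g xs lt = argmin g v₀ outside , argmin∉xs , least
    where
    v₀ : Fin m
    v₀ = proj₁ (∃-∉ xs lt)
    outside : List (Fin m)
    outside = filter (λ u → ¬? (u ∈? xs)) (allFin m)
    argmin∉xs : argmin g v₀ outside ∉ xs
    argmin∉xs with argmin-sel g v₀ outside
    ... | inj₁ ≡v₀ = subst (_∉ xs) (sym ≡v₀) (proj₂ (∃-∉ xs lt))
    ... | inj₂ ∈outside = proj₂ (∈-filter⁻ (λ u → ¬? (u ∈? xs)) {xs = allFin m} ∈outside)
    least : ∀ u → u ∉ xs → g (argmin g v₀ outside) ≤ g u
    least u u∉xs = All.lookup (f[argmin]≤f[xs] v₀ outside) (∈-filter⁺ (λ u → ¬? (u ∈? xs)) (∈-allFin u) u∉xs)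

LeastOutside-∈⊎≥ : ∀ {m} {g : Fin m → ℕ} {xs v} → LeastOutside g xs v → ∀ u → u ∈ xs ⊎ g v ≤ g u
LeastOutside-∈⊎≥ {xs = xs} (_ , least) u with u ∈? xs
... | yes u∈xs = inj₁ u∈xs
... | no u∉xs = inj₂ (least u u∉xs)

-- The vertex part of a super edge-magic labelling of (K_m − ab) ∪ kK₁: the edge labels
-- c − (f u + f v) are distinct and fill the interval above the vertex labels.
record ConsecutiveSumLabelling (m : ℕ) : Set where
  field
    f : Fin m → ℕ
    a b : Fin m
    f-injective : ∀ {u v} → f u ≡ f v → u ≡ v
    sum-injective : ∀ {u v u′ v′} → Adjacent a b u v → Adjacent a b u′ v′ →
                    f u + f v ≡ f u′ + f v′ → SamePair u v u′ v′
    sum-convex : ∀ {u v u′ v′} σ → Adjacent a b u v → Adjacent a b u′ v′ →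
                 f u + f v ≤ σ → σ ≤ f u′ + f v′ → ∃₂ λ x y → Adjacent a b x y × f x + f y ≡ σ

  Consecutive : Fin m → Fin m → Set
  Consecutive x y = f y ≡ suc (f x)

module LabellingProperties {m} (L : ConsecutiveSumLabelling m) where
  open ConsecutiveSumLabelling L

  f-<⇒≢ : ∀ {x y} → f x < f y → x ≢ y
  f-<⇒≢ lt refl = <-irrefl refl lt

  adjacent : ∀ {x y} → f x < f y → ¬ SamePair x y a b → Adjacent a b x y
  adjacent lt ¬missing = f-<⇒≢ lt , ¬missing

  sum-<⇒¬SamePair : ∀ {x y z w} → f z + f w < f x + f y → ¬ SamePair x y z w
  sum-<⇒¬SamePair lt same = <⇒≢ lt (sym (SamePair-sum f same))

  next-sum : ∀ {u v u′ v′} → Adjacent a b u v → Adjacent a b u′ v′ → f u + f v < f u′ + f v′ →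
             ∃₂ λ x y → Adjacent a b x y × f x + f y ≡ suc (f u + f v)
  next-sum adj adj′ lt = sum-convex _ adj adj′ (n≤1+n _) lt

  missing-ordered : ∀ {x y x′ y′} → SamePair x y a b → SamePair x′ y′ a b →
                    f x < f y → f x′ < f y′ → x ≡ x′ × y ≡ y′
  missing-ordered missing missing′ =
    SamePair-ordered f (SamePair-trans missing (SamePair-sym missing′))

  -- The pairs {x, y′} and {x′, y} have the same sum.
  collision : ∀ {x x′ y y′} → Consecutive x x′ → Consecutive y y′ → f x′ < f y →
              SamePair x y′ a b ⊎ SamePair x′ y a b
  collision {x} {x′} {y} {y′} x→x′ y→y′ x′<y with samePair? x y′ a b | samePair? x′ y a b
  ... | yes missing | _ = inj₁ missing
  ... | no _ | yes missing = inj₂ missing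
  ... | no ¬m | no ¬m′ =
    contradiction (sum-injective (adjacent x<y′ ¬m) (adjacent x′<y ¬m′) equal-sums) impossible
    where
    x<x′ : f x < f x′
    x<x′ = ≤-reflexive (sym x→x′)
    x<y′ : f x < f y′
    x<y′ = <-trans (<-trans x<x′ x′<y) (≤-reflexive (sym y→y′))
    equal-sums : f x + f y′ ≡ f x′ + f y
    equal-sums = begin
      f x + f y′       ≡⟨ cong (f x +_) y→y′ ⟩
      f x + suc (f y)  ≡⟨ +-suc (f x) (f y) ⟩
      suc (f x) + f y  ≡⟨ cong (_+ f y) x→x′ ⟨
      f x′ + f y       ∎
      where open ≡-Reasoning
    impossible : ¬ SamePair x y′ x′ y
    impossible (inj₁ (x≡x′ , _)) = f-<⇒≢ x<x′ x≡x′
    impossible (inj₂ (x≡y , _)) = f-<⇒≢ (<-trans x<x′ x′<y) x≡y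

module LowestFour {m} (L : ConsecutiveSumLabelling m) (4≤m : 4 ≤ m) where
  open ConsecutiveSumLabelling L
  open LabellingProperties L

  private
    choose : (xs : List (Fin m)) → length xs < 4 → ∃ (LeastOutside f xs)
    choose xs lt = leastOutside f xs (<-≤-trans lt 4≤m)

  s₁ s₂ s₃ s₄ : Fin m
  s₁ = proj₁ (choose [] z<s)
  s₂ = proj₁ (choose (s₁ ∷ []) (s<s z<s))
  s₃ = proj₁ (choose (s₂ ∷ s₁ ∷ []) (s<s (s<s z<s)))
  s₄ = proj₁ (choose (s₃ ∷ s₂ ∷ s₁ ∷ []) (s<s (s<s (s<s z<s))))

  least₁ : LeastOutside f [] s₁
  least₁ = proj₂ (choose [] z<s)
  least₂ : LeastOutside f (s₁ ∷ []) s₂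
  least₂ = proj₂ (choose (s₁ ∷ []) (s<s z<s))
  least₃ : LeastOutside f (s₂ ∷ s₁ ∷ []) s₃
  least₃ = proj₂ (choose (s₂ ∷ s₁ ∷ []) (s<s (s<s z<s)))
  least₄ : LeastOutside f (s₃ ∷ s₂ ∷ s₁ ∷ []) s₄
  least₄ = proj₂ (choose (s₃ ∷ s₂ ∷ s₁ ∷ []) (s<s (s<s (s<s z<s))))

  least-step : ∀ {xs v w} → LeastOutside f xs v → LeastOutside f (v ∷ xs) w → f v < f w
  least-step (_ , least) (w∉v∷xs , _) =
    ≤∧≢⇒< (least _ (w∉v∷xs ∘ there)) (λ fv≡fw → w∉v∷xs (here (f-injective (sym fv≡fw))))

  s₁<s₂ : f s₁ < f s₂
  s₁<s₂ = least-step least₁ least₂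
  s₂<s₃ : f s₂ < f s₃
  s₂<s₃ = least-step least₂ least₃
  s₃<s₄ : f s₃ < f s₄
  s₃<s₄ = least-step least₃ least₄

  s₁≤ : ∀ u → f s₁ ≤ f u
  s₁≤ u = proj₂ least₁ u λ ()

  s₁+s₃≤ : ∀ {u v} → u ≢ v → ¬ SamePair u v s₁ s₂ → f s₁ + f s₃ ≤ f u + f v
  s₁+s₃≤ {u} {v} u≢v ¬12 with LeastOutside-∈⊎≥ least₃ u | LeastOutside-∈⊎≥ least₃ v
  ... | _ | inj₂ s₃≤v = +-mono-≤ (s₁≤ u) s₃≤v
  ... | inj₂ s₃≤u | _ = subst (f s₁ + f s₃ ≤_) (+-comm (f v) (f u)) (+-mono-≤ (s₁≤ v) s₃≤u)
  ... | inj₁ (here refl) | inj₁ (here refl) = contradiction refl u≢v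
  ... | inj₁ (here refl) | inj₁ (there (here refl)) = contradiction (inj₂ (refl , refl)) ¬12
  ... | inj₁ (there (here refl)) | inj₁ (here refl) = contradiction (inj₁ (refl , refl)) ¬12
  ... | inj₁ (there (here refl)) | inj₁ (there (here refl)) = contradiction refl u≢v

  s₁+s₄≤⊎s₂+s₃≤ : ∀ {u v} → u ≢ v → ¬ SamePair u v s₁ s₂ → ¬ SamePair u v s₁ s₃ →
                  f s₁ + f s₄ ≤ f u + f v ⊎ f s₂ + f s₃ ≤ f u + f v
  s₁+s₄≤⊎s₂+s₃≤ {u} {v} u≢v ¬12 ¬13 with LeastOutside-∈⊎≥ least₄ u | LeastOutside-∈⊎≥ least₄ v
  ... | _ | inj₂ s₄≤v = inj₁ (+-mono-≤ (s₁≤ u) s₄≤v)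
  ... | inj₂ s₄≤u | _ = inj₁ (subst (f s₁ + f s₄ ≤_) (+-comm (f v) (f u)) (+-mono-≤ (s₁≤ v) s₄≤u))
  ... | inj₁ (here refl) | inj₁ (here refl) = contradiction refl u≢v
  ... | inj₁ (here refl) | inj₁ (there (here refl)) = inj₂ (≤-reflexive (+-comm (f s₂) (f s₃)))
  ... | inj₁ (here refl) | inj₁ (there (there (here refl))) = contradiction (inj₂ (refl , refl)) ¬13
  ... | inj₁ (there (here refl)) | inj₁ (here refl) = inj₂ ≤-refl
  ... | inj₁ (there (here refl)) | inj₁ (there (here refl)) = contradiction refl u≢v
  ... | inj₁ (there (here refl)) | inj₁ (there (there (here refl))) = contradiction (inj₂ (refl , refl)) ¬12
  ... | inj₁ (there (there (here refl))) | inj₁ (here refl) = contradiction (inj₁ (refl , refl)) ¬13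
  ... | inj₁ (there (there (here refl))) | inj₁ (there (here refl)) = contradiction (inj₁ (refl , refl)) ¬12
  ... | inj₁ (there (there (here refl))) | inj₁ (there (there (here refl))) = contradiction refl u≢v

  s₁+s₂+1⇒s₁s₃ : ∀ {x y} → x ≢ y → f x + f y ≡ suc (f s₁ + f s₂) → ¬ ¬ SamePair x y s₁ s₃
  s₁+s₂+1⇒s₁s₃ x≢y sum ¬13 with s₁+s₄≤⊎s₂+s₃≤ x≢y (sum-<⇒¬SamePair (≤-reflexive (sym sum))) ¬13
  ... | inj₁ le = <⇒≱ (≤-trans (s≤s s₂<s₃) s₃<s₄)
                      (+-cancelˡ-≤-suc (f s₁) (subst (f s₁ + f s₄ ≤_) sum le))
  ... | inj₂ le = <⇒≱ (≤-trans (s≤s s₁<s₂) s₂<s₃)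
                      (+-cancelʳ-≤-suc (f s₂) (subst₂ _≤_ (+-comm (f s₂) (f s₃)) sum le))

  s₁+s₂+1⇒s₂→s₃ : ∀ {x y} → x ≢ y → f x + f y ≡ suc (f s₁ + f s₂) → Consecutive s₂ s₃
  s₁+s₂+1⇒s₂→s₃ x≢y sum =
    ≤-antisym (+-cancelˡ-≤-suc (f s₁)
                (subst (f s₁ + f s₃ ≤_) sum (s₁+s₃≤ x≢y (sum-<⇒¬SamePair (≤-reflexive (sym sum))))))
              s₂<s₃

  ¬missing-s₁s₃ : ¬ SamePair s₁ s₃ a b
  ¬missing-s₁s₃ m₁₃ =
    let x , y , (x≢y , ¬mxy) , sum = next-sum adj₁₂ adj₂₃ s₁+s₂<s₂+s₃
    in s₁+s₂+1⇒s₁s₃ x≢y sum (¬mxy ∘ flip SamePair-trans m₁₃)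
    where
    adj₁₂ : Adjacent a b s₁ s₂
    adj₁₂ = adjacent s₁<s₂ λ m₁₂ →
      f-<⇒≢ s₂<s₃ (proj₂ (missing-ordered m₁₂ m₁₃ s₁<s₂ (<-trans s₁<s₂ s₂<s₃)))
    adj₂₃ : Adjacent a b s₂ s₃
    adj₂₃ = adjacent s₂<s₃ λ m₂₃ →
      f-<⇒≢ s₁<s₂ (sym (proj₁ (missing-ordered m₂₃ m₁₃ s₂<s₃ (<-trans s₁<s₂ s₂<s₃))))
    s₁+s₂<s₂+s₃ : f s₁ + f s₂ < f s₂ + f s₃
    s₁+s₂<s₂+s₃ = subst (f s₁ + f s₂ <_) (+-comm (f s₃) (f s₂)) (+-monoˡ-< (f s₂) (<-trans s₁<s₂ s₂<s₃))

  s₂→s₃ : ¬ SamePair s₁ s₂ a b → Consecutive s₂ s₃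
  s₂→s₃ ¬m₁₂ =
    let x , y , (x≢y , _) , sum =
          next-sum (adjacent s₁<s₂ ¬m₁₂) (adjacent (<-trans s₁<s₂ s₂<s₃) ¬missing-s₁s₃) (+-monoʳ-< (f s₁) s₂<s₃)
    in s₁+s₂+1⇒s₂→s₃ x≢y sum

  above-s₁+s₃ : ∃₂ λ u v → Adjacent a b u v × f s₁ + f s₃ < f u + f v
  above-s₁+s₃ with samePair? s₁ s₄ a b
  ... | no ¬m₁₄ = s₁ , s₄ , adjacent (<-trans s₁<s₂ (<-trans s₂<s₃ s₃<s₄)) ¬m₁₄ , +-monoʳ-< (f s₁) s₃<s₄
  ... | yes m₁₄ = s₂ , s₃ , adjacent s₂<s₃ ¬m₂₃ , +-monoˡ-< (f s₃) s₁<s₂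
    where
    ¬m₂₃ : ¬ SamePair s₂ s₃ a b
    ¬m₂₃ m₂₃ = f-<⇒≢ s₁<s₂ (sym (proj₁
      (missing-ordered m₂₃ m₁₄ s₂<s₃ (<-trans s₁<s₂ (<-trans s₂<s₃ s₃<s₄)))))

  s₁+s₃+1⇒s₃→s₄⊎s₁→s₂ : ∀ {x y} → x ≢ y → f x + f y ≡ suc (f s₁ + f s₃) →
                        Consecutive s₃ s₄ ⊎ Consecutive s₁ s₂
  s₁+s₃+1⇒s₃→s₄⊎s₁→s₂ x≢y sum with s₁+s₄≤⊎s₂+s₃≤ x≢y ¬12 ¬13
    where
    ¬12 : ¬ SamePair _ _ s₁ s₂
    ¬12 = sum-<⇒¬SamePair (<-trans (+-monoʳ-< (f s₁) s₂<s₃) (≤-reflexive (sym sum)))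
    ¬13 : ¬ SamePair _ _ s₁ s₃
    ¬13 = sum-<⇒¬SamePair (≤-reflexive (sym sum))
  ... | inj₁ le = inj₁ (≤-antisym (+-cancelˡ-≤-suc (f s₁) (subst (f s₁ + f s₄ ≤_) sum le)) s₃<s₄)
  ... | inj₂ le = inj₂ (≤-antisym (+-cancelʳ-≤-suc (f s₃) (subst (f s₂ + f s₃ ≤_) sum le)) s₁<s₂)

  s₃→s₄⊎s₁→s₂ : Consecutive s₃ s₄ ⊎ Consecutive s₁ s₂
  s₃→s₄⊎s₁→s₂ =
    let u , v , adj , lt = above-s₁+s₃
        x , y , (x≢y , _) , sum = next-sum (adjacent (<-trans s₁<s₂ s₂<s₃) ¬missing-s₁s₃) adj lt
    in s₁+s₃+1⇒s₃→s₄⊎s₁→s₂ x≢y sum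

  consecutive-up-to-s₄ : ∃₂ λ x y → Consecutive x y × f y ≤ f s₄
  consecutive-up-to-s₄ =
    [ (λ s₃→s₄ → s₃ , s₄ , s₃→s₄ , ≤-refl)
    , (λ s₁→s₂ → s₁ , s₂ , s₁→s₂ , <⇒≤ (<-trans s₂<s₃ s₃<s₄))
    ]′ s₃→s₄⊎s₁→s₂

module Reflection {m} (L : ConsecutiveSumLabelling m) where
  open ConsecutiveSumLabelling L

  C : ℕ
  C = max 0 (map f (allFin m))

  f≤C : ∀ u → f u ≤ C
  f≤C u = All.lookup (xs≤max 0 (map f (allFin m))) (∈-map⁺ f (∈-allFin u))

  f* : Fin m → ℕ
  f* u = C ∸ f u

  f*+f : ∀ u → f* u + f u ≡ C
  f*+f u = m∸n+n≡m (f≤C u)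

  f*+f-balanced : ∀ u v → f* u + f u ≡ f* v + f v
  f*+f-balanced u v = trans (f*+f u) (sym (f*+f v))

  sums-complementary : ∀ u v → (f* u + f* v) + (f u + f v) ≡ C + C
  sums-complementary u v = trans (interchange (f* u) (f* v) (f u) (f v)) (cong₂ _+_ (f*+f u) (f*+f v))

  sums-balanced : ∀ u v u′ v′ → (f* u + f* v) + (f u + f v) ≡ (f* u′ + f* v′) + (f u′ + f v′)
  sums-balanced u v u′ v′ = trans (sums-complementary u v) (sym (sums-complementary u′ v′))

  reflect : ConsecutiveSumLabelling m
  reflect = record
    { f = f*
    ; a = a
    ; b = b
    ; f-injective = λ {u} {v} eq → f-injective (balanced-≡ (f*+f-balanced u v) eq)
    ; sum-injective = λ {u} {v} {u′} {v′} adj adj′ eq →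
        sum-injective adj adj′ (balanced-≡ (sums-balanced u v u′ v′) eq)
    ; sum-convex = convex
    }
    where
    convex : ∀ {u v u′ v′} σ → Adjacent a b u v → Adjacent a b u′ v′ →
             f* u + f* v ≤ σ → σ ≤ f* u′ + f* v′ → ∃₂ λ x y → Adjacent a b x y × f* x + f* y ≡ σ
    convex {u} {v} {u′} {v′} σ adj adj′ lo hi =
      let x , y , adj″ , sum = sum-convex σ* adj′ adj (balanced-≤ σ-balanced′ hi) (balanced-≤ σ-balanced lo)
      in x , y , adj″ , balanced-≡ʳ (trans (sums-complementary x y) (sym σ+σ*)) sum
      where
      σ* : ℕ
      σ* = (C + C) ∸ σ
      σ+σ* : σ + σ* ≡ C + C
      σ+σ* = m+[n∸m]≡n (≤-trans hi (≤-trans (m≤m+n _ _) (≤-reflexive (sums-complementary u′ v′))))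
      σ-balanced : (f* u + f* v) + (f u + f v) ≡ σ + σ*
      σ-balanced = trans (sums-complementary u v) (sym σ+σ*)
      σ-balanced′ : σ + σ* ≡ (f* u′ + f* v′) + (f u′ + f v′)
      σ-balanced′ = trans σ+σ* (sym (sums-complementary u′ v′))

  reflect-< : ∀ {x y} → f* x < f* y → f y < f x
  reflect-< {x} {y} = balanced-< (f*+f-balanced x y)

  reflect-≤ : ∀ {x y} → f* x ≤ f* y → f y ≤ f x
  reflect-≤ {x} {y} = balanced-≤ (f*+f-balanced x y)

  reflect-consecutive : ∀ {x y} → ConsecutiveSumLabelling.Consecutive reflect x y → Consecutive y x
  reflect-consecutive {x} {y} = balanced-suc (f*+f-balanced x y)

module ExtremeVertices {m} (L : ConsecutiveSumLabelling m) (8≤m : 8 ≤ m) where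
  open ConsecutiveSumLabelling L
  open LabellingProperties L
  open Reflection L

  4≤m : 4 ≤ m
  4≤m = ≤-trans (m≤n+m 4 4) 8≤m

  open LowestFour L 4≤m
  module Top = LowestFour reflect 4≤m

  t₁ t₂ t₃ t₄ : Fin m
  t₁ = Top.s₁
  t₂ = Top.s₂
  t₃ = Top.s₃
  t₄ = Top.s₄

  t₂<t₁ : f t₂ < f t₁
  t₂<t₁ = reflect-< Top.s₁<s₂
  t₃<t₂ : f t₃ < f t₂
  t₃<t₂ = reflect-< Top.s₂<s₃
  t₄<t₃ : f t₄ < f t₃
  t₄<t₃ = reflect-< Top.s₃<s₄

  t₃→t₂ : ¬ SamePair t₁ t₂ a b → Consecutive t₃ t₂
  t₃→t₂ = reflect-consecutive ∘ Top.s₂→s₃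

  consecutive-from-t₄ : ∃₂ λ x y → Consecutive x y × f t₄ ≤ f x
  consecutive-from-t₄ =
    let x , y , x→y , y≤t₄ = Top.consecutive-up-to-s₄
    in y , x , reflect-consecutive x→y , reflect-≤ y≤t₄

  s₄<t₄ : f s₄ < f t₄
  s₄<t₄ with f s₄ <? f t₄
  ... | yes lt = lt
  ... | no s₄≮t₄ = ⊥-elim (o∉ (∈-++⁺ʳ (t₃ ∷ t₂ ∷ t₁ ∷ []) (here (f-injective (≤-antisym o≤s₄ s₄≤o)))))
    where
    fresh : ∃ (_∉ (t₃ ∷ t₂ ∷ t₁ ∷ []) ++ s₄ ∷ s₃ ∷ s₂ ∷ s₁ ∷ [])
    fresh = ∃-∉ _ 8≤m
    o : Fin m
    o = proj₁ fresh
    o∉ : o ∉ (t₃ ∷ t₂ ∷ t₁ ∷ []) ++ s₄ ∷ s₃ ∷ s₂ ∷ s₁ ∷ []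
    o∉ = proj₂ fresh
    s₄≤o : f s₄ ≤ f o
    s₄≤o = proj₂ least₄ o (o∉ ∘ ∈-++⁺ʳ (t₃ ∷ t₂ ∷ t₁ ∷ s₄ ∷ []))
    o≤s₄ : f o ≤ f s₄
    o≤s₄ = ≤-trans (reflect-≤ (proj₂ Top.least₄ o (o∉ ∘ ∈-++⁺ˡ))) (≮⇒≥ s₄≮t₄)

  s₃<t₃ : f s₃ < f t₃
  s₃<t₃ = <-trans s₃<s₄ (<-trans s₄<t₄ t₄<t₃)

  Endpoint : Fin m → Set
  Endpoint w = w ≡ a ⊎ w ≡ b

  endpointˡ : ∀ {x y} → SamePair x y a b → Endpoint x
  endpointˡ (inj₁ (x≡a , _)) = inj₁ x≡a
  endpointˡ (inj₂ (x≡b , _)) = inj₂ x≡b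

  endpointʳ : ∀ {x y} → SamePair x y a b → Endpoint y
  endpointʳ (inj₁ (_ , y≡b)) = inj₂ y≡b
  endpointʳ (inj₂ (_ , y≡a)) = inj₁ y≡a

  endpoints-below-t₃ : (∀ {w} → Endpoint w → f w < f t₃) → ⊥
  endpoints-below-t₃ below =
    let x , x′ , x→x′ , x′≤s₄ = consecutive-up-to-s₄
    in [ not-high (<⇒≤ t₃<t₂) , not-high ≤-refl ]′
         (collision x→x′ (t₃→t₂ (not-high (<⇒≤ t₃<t₂))) (≤-<-trans x′≤s₄ (<-trans s₄<t₄ t₄<t₃)))
    where
    not-high : ∀ {x y} → f t₃ ≤ f y → ¬ SamePair x y a b
    not-high t₃≤y missing = <⇒≱ (below (endpointʳ missing)) t₃≤y

  endpoints-above-s₃ : (∀ {w} → Endpoint w → f s₃ < f w) → ⊥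
  endpoints-above-s₃ above =
    let y , y′ , y→y′ , t₄≤y = consecutive-from-t₄
    in [ not-low (<⇒≤ s₂<s₃) , not-low ≤-refl ]′
         (collision (s₂→s₃ (not-low (s₁≤ s₃))) y→y′ (<-≤-trans (<-trans s₃<s₄ s₄<t₄) t₄≤y))
    where
    not-low : ∀ {x y} → f x ≤ f s₃ → ¬ SamePair x y a b
    not-low x≤s₃ missing = <⇒≱ (above (endpointˡ missing)) x≤s₃

  -- Colliding (s₂, s₃) and (p, p′) with (t₃, t₂) puts ab both in {s₂t₂, s₃t₃} and in {pt₂, p′t₃}.
  straddling : ∀ {u w} → SamePair u w a b → f u ≤ f s₃ → f t₃ ≤ f w → ⊥
  straddling {u} {w} missing u≤s₃ t₃≤w =
    [ excluded (<⇒≢ s₂<s₃ ∘ sym) (<⇒≢ s₃<s₄ ∘ sym) (<-trans s₄<t₄ t₄<t₃)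
    , excluded (<⇒≢ s₁<s₂) (<⇒≢ s₂<s₃) (<-trans s₂<s₃ s₃<t₃)
    ]′ s₃→s₄⊎s₁→s₂
    where
    locate : ∀ {x y} → f x < f y → SamePair x y a b → f u ≡ f x × f w ≡ f y
    locate x<y missing′ =
      let u≡x , w≡y = missing-ordered missing missing′ (≤-<-trans u≤s₃ (<-≤-trans s₃<t₃ t₃≤w)) x<y
      in cong f u≡x , cong f w≡y
    s₂→s₃′ : Consecutive s₂ s₃
    s₂→s₃′ = s₂→s₃ λ m₁₂ →
      <⇒≱ (<-trans s₂<s₃ s₃<t₃) (subst (f t₃ ≤_) (proj₂ (locate s₁<s₂ m₁₂)) t₃≤w)
    t₃→t₂′ : Consecutive t₃ t₂
    t₃→t₂′ = t₃→t₂ λ m₁₂ →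
      <⇒≱ (<-trans s₃<t₃ t₃<t₂) (subst (_≤ f s₃) (proj₁ (locate t₂<t₁ (SamePair-swap m₁₂))) u≤s₃)
    excluded : ∀ {p p′} → f p ≢ f s₂ → f p′ ≢ f s₃ → f p′ < f t₃ → Consecutive p p′ → ⊥
    excluded {p} {p′} p≢s₂ p′≢s₃ p′<t₃ p→p′ =
      compare (Sum.map (locate (<-trans s₂<s₃ (<-trans s₃<t₃ t₃<t₂))) (locate s₃<t₃)
                       (collision s₂→s₃′ t₃→t₂′ s₃<t₃))
              (Sum.map (locate (<-trans (≤-reflexive (sym p→p′)) (<-trans p′<t₃ t₃<t₂))) (locate p′<t₃)
                       (collision p→p′ t₃→t₂′ p′<t₃))
      where
      compare : (f u ≡ f s₂ × f w ≡ f t₂) ⊎ (f u ≡ f s₃ × f w ≡ f t₃) →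
                (f u ≡ f p × f w ≡ f t₂) ⊎ (f u ≡ f p′ × f w ≡ f t₃) → ⊥
      compare (inj₁ (u=s₂ , _)) (inj₁ (u=p , _)) = p≢s₂ (trans (sym u=p) u=s₂)
      compare (inj₁ (_ , w=t₂)) (inj₂ (_ , w=t₃)) = <⇒≢ t₃<t₂ (trans (sym w=t₃) w=t₂)
      compare (inj₂ (_ , w=t₃)) (inj₁ (_ , w=t₂)) = <⇒≢ t₃<t₂ (trans (sym w=t₃) w=t₂)
      compare (inj₂ (u=s₃ , _)) (inj₂ (u=p′ , _)) = p′≢s₃ (trans (sym u=p′) u=s₃)

  endpoint-cases : (∀ {w} → Endpoint w → f w < f t₃) ⊎ (∀ {w} → Endpoint w → f s₃ < f w) ⊎
                   ∃₂ λ u w → SamePair u w a b × f u ≤ f s₃ × f t₃ ≤ f w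
  endpoint-cases with f a <? f t₃ | f b <? f t₃ | f s₃ <? f a | f s₃ <? f b
  ... | yes a<t₃ | yes b<t₃ | _ | _ = inj₁ λ { (inj₁ refl) → a<t₃ ; (inj₂ refl) → b<t₃ }
  ... | no a≮t₃ | _ | _ | yes s₃<b =
    inj₂ (inj₁ λ { (inj₁ refl) → <-≤-trans s₃<t₃ (≮⇒≥ a≮t₃) ; (inj₂ refl) → s₃<b })
  ... | no a≮t₃ | _ | _ | no s₃≮b = inj₂ (inj₂ (b , a , inj₂ (refl , refl) , ≮⇒≥ s₃≮b , ≮⇒≥ a≮t₃))
  ... | yes _ | no b≮t₃ | yes s₃<a | _ =
    inj₂ (inj₁ λ { (inj₁ refl) → s₃<a ; (inj₂ refl) → <-≤-trans s₃<t₃ (≮⇒≥ b≮t₃) })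
  ... | yes _ | no b≮t₃ | no s₃≮a | _ = inj₂ (inj₂ (a , b , inj₁ (refl , refl) , ≮⇒≥ s₃≮a , ≮⇒≥ b≮t₃))

  absurd : ⊥
  absurd =
    [ endpoints-below-t₃
    , [ endpoints-above-s₃ , (λ (_ , _ , missing , u≤s₃ , t₃≤w) → straddling missing u≤s₃ t₃≤w) ]′
    ]′ endpoint-cases

no-consecutive-sum-labelling : ∀ {m} → 8 ≤ m → ¬ ConsecutiveSumLabelling m
no-consecutive-sum-labelling 8≤m L = ExtremeVertices.absurd L 8≤m

module KminusEplusIso (n k : ℕ) (a b : Fin (n + 1)) where

  p : ℕ
  p = n + 1 + k

  G : Adjacency p
  G = adjKminusEplusIso n k a b

  adjacency-reflects : ∀ u v →
    (not ⌊ u ≟ v ⌋ ∧ not ((⌊ u ≟ a ⌋ ∧ ⌊ v ≟ b ⌋) ∨ (⌊ u ≟ b ⌋ ∧ ⌊ v ≟ a ⌋))) ≡ ⌊ adjacent? a b u v ⌋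
  adjacency-reflects u v
    rewrite isYes≗does (adjacent? a b u v) | isYes≗does (u ≟ v)
          | isYes≗does (u ≟ a) | isYes≗does (v ≟ b) | isYes≗does (u ≟ b) | isYes≗does (v ≟ a) = refl

  G-↑ˡ : ∀ u v → G (u ↑ˡ k) (v ↑ˡ k) ≡ ⌊ adjacent? a b u v ⌋
  G-↑ˡ u v rewrite splitAt-↑ˡ (n + 1) u k | splitAt-↑ˡ (n + 1) v k = adjacency-reflects u v

  G-true : ∀ {u v} → Adjacent a b u v → T (G (u ↑ˡ k) (v ↑ˡ k))
  G-true {u} {v} adj = subst T (sym (G-↑ˡ u v)) (fromWitness adj)

  ordered-edge : ∀ {u v} → toℕ u < toℕ v → Adjacent a b u v → Edge p G
  ordered-edge {u} {v} u<v adj =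
    (u ↑ˡ k , v ↑ˡ k) , subst₂ _<_ (sym (toℕ-↑ˡ u k)) (sym (toℕ-↑ˡ v k)) u<v , G-true adj

  edge : ∀ {u v} → Adjacent a b u v → Σ (Edge p G) λ e → SamePair (src e) (tgt e) (u ↑ˡ k) (v ↑ˡ k)
  edge {u} {v} adj with <-cmp (toℕ u) (toℕ v)
  ... | tri< u<v _ _ = ordered-edge u<v adj , inj₁ (refl , refl)
  ... | tri≈ _ u≡v _ = contradiction (toℕ-injective u≡v) (proj₁ adj)
  ... | tri> _ _ v<u = ordered-edge v<u (Adjacent-sym adj) , inj₂ (refl , refl)

  edge-ends : (e : Edge p G) → ∃₂ λ u v → src e ≡ u ↑ˡ k × tgt e ≡ v ↑ˡ k × Adjacent a b u v
  edge-ends ((i , j) , _ , Gij) with splitAt (n + 1) i in i≡ | splitAt (n + 1) j in j≡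
  ... | inj₁ u | inj₁ v =
    u , v , sym (splitAt⁻¹-↑ˡ i≡) , sym (splitAt⁻¹-↑ˡ j≡) , toWitness (subst T (adjacency-reflects u v) Gij)
  ... | inj₁ _ | inj₂ _ = ⊥-elim Gij
  ... | inj₂ _ | _ = ⊥-elim Gij

module FromSuperEdgeMagic (n k : ℕ) (a b : Fin (n + 1))
         (sem : SuperEdgeMagic (n + 1 + k) (adjKminusEplusIso n k a b)) where
  open KminusEplusIso n k a b

  N : ℕ
  N = proj₁ sem

  bijection : (Fin p ⊎ Edge p G) ⤖ Fin N
  bijection = proj₁ (proj₂ sem)

  label : Fin p ⊎ Edge p G → ℕ
  label x = suc (toℕ (Bijection.to bijection x))

  vertex-label≤p : ∀ v → label (inj₁ v) ≤ p
  vertex-label≤p = proj₁ (proj₂ (proj₂ sem))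

  vertex-labels-onto : ∀ ℓ → 1 ≤ ℓ → ℓ ≤ p → ∃ λ v → label (inj₁ v) ≡ ℓ
  vertex-labels-onto = proj₁ (proj₂ (proj₂ (proj₂ sem)))

  c : ℕ
  c = proj₁ (proj₂ (proj₂ (proj₂ (proj₂ sem))))

  magic : ∀ e → label (inj₁ (src e)) + label (inj₁ (tgt e)) + label (inj₂ e) ≡ c
  magic = proj₂ (proj₂ (proj₂ (proj₂ (proj₂ sem))))

  label-injective : ∀ {x y} → label x ≡ label y → x ≡ y
  label-injective eq = Bijection.injective bijection (toℕ-injective (suc-injective eq))

  label-onto : ∀ ℓ → 1 ≤ ℓ → ℓ ≤ N → ∃ λ x → label x ≡ ℓ
  label-onto (suc ℓ) _ ℓ<N =
    let x , to-x≡ = Bijection.strictlySurjective bijection (fromℕ< ℓ<N)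
    in x , cong suc (trans (cong toℕ to-x≡) (toℕ-fromℕ< ℓ<N))

  label≤N : ∀ x → label x ≤ N
  label≤N x = toℕ<n (Bijection.to bijection x)

  p<edge-label : ∀ e → p < label (inj₂ e)
  p<edge-label e = ≰⇒> λ ≤p →
    let v , same = vertex-labels-onto (label (inj₂ e)) (s≤s z≤n) ≤p
    in case label-injective same of λ ()

  f : Fin (n + 1) → ℕ
  f u = label (inj₁ (u ↑ˡ k))

  edge-magic : ∀ {u v} (e : Edge p G) → SamePair (src e) (tgt e) (u ↑ˡ k) (v ↑ˡ k) →
               f u + f v + label (inj₂ e) ≡ c
  edge-magic e same = trans (cong (_+ label (inj₂ e)) (sym (SamePair-sum (label ∘ inj₁) same))) (magic e)

  edge-label-sum : ∀ ℓ → p < ℓ → ℓ ≤ N → ∃₂ λ x y → Adjacent a b x y × f x + f y + ℓ ≡ c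
  edge-label-sum ℓ p<ℓ ℓ≤N with label-onto ℓ (≤-trans (s≤s z≤n) p<ℓ) ℓ≤N
  ... | inj₁ v , ≡ℓ = contradiction (subst (_≤ p) ≡ℓ (vertex-label≤p v)) (<⇒≱ p<ℓ)
  ... | inj₂ e , ≡ℓ =
    let x , y , src≡ , tgt≡ , adj = edge-ends e
    in x , y , adj , subst (λ ℓ → f x + f y + ℓ ≡ c) ≡ℓ (edge-magic e (inj₁ (src≡ , tgt≡)))

  sum-injective : ∀ {u v u′ v′} → Adjacent a b u v → Adjacent a b u′ v′ →
                  f u + f v ≡ f u′ + f v′ → SamePair u v u′ v′
  sum-injective adj adj′ eq with edge adj | edge adj′
  ... | e , ends | e′ , ends′
      with label-injective (balanced-≡ (trans (edge-magic e ends) (sym (edge-magic e′ ends′))) eq)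
  ... | refl = SamePair-injective (↑ˡ-injective k _ _) (SamePair-trans (SamePair-sym ends) ends′)

  sum-convex : ∀ {u v u′ v′} σ → Adjacent a b u v → Adjacent a b u′ v′ →
               f u + f v ≤ σ → σ ≤ f u′ + f v′ → ∃₂ λ x y → Adjacent a b x y × f x + f y ≡ σ
  sum-convex σ adj adj′ lo hi =
    let x , y , adj″ , sum = edge-label-sum (c ∸ σ) p<ℓ ℓ≤N
    in x , y , adj″ , +-cancelʳ-≡ (c ∸ σ) _ _ (trans sum (sym σ+ℓ))
    where
    S+ℓ : f _ + f _ + label (inj₂ (proj₁ (edge adj))) ≡ c
    S+ℓ = edge-magic _ (proj₂ (edge adj))
    S′+ℓ′ : f _ + f _ + label (inj₂ (proj₁ (edge adj′))) ≡ c
    S′+ℓ′ = edge-magic _ (proj₂ (edge adj′))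
    σ+ℓ : σ + (c ∸ σ) ≡ c
    σ+ℓ = m+[n∸m]≡n (≤-trans hi (≤-trans (m≤m+n _ _) (≤-reflexive S′+ℓ′)))
    p<ℓ : p < c ∸ σ
    p<ℓ = <-≤-trans (p<edge-label _) (balanced-≤ (trans σ+ℓ (sym S′+ℓ′)) hi)
    ℓ≤N : c ∸ σ ≤ N
    ℓ≤N = ≤-trans (balanced-≤ (trans S+ℓ (sym σ+ℓ)) lo) (label≤N _)

  labelling : ConsecutiveSumLabelling (n + 1)
  labelling = record
    { f = f
    ; a = a
    ; b = b
    ; f-injective = ↑ˡ-injective k _ _ ∘ inj₁-injective ∘ label-injective
    ; sum-injective = sum-injective
    ; sum-convex = sum-convex
    }

mainTheorem2 : (n : ℕ) → 7 ≤ n → (a b : Fin (n + 1)) → a ≢ b →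
    (k : ℕ) → ¬ SuperEdgeMagic (n + 1 + k) (adjKminusEplusIso n k a b)
mainTheorem2 n 7≤n a b _ k sem =
  no-consecutive-sum-labelling (+-monoˡ-≤ 1 7≤n) (FromSuperEdgeMagic.labelling n k a b sem)
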